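{- Let $P$ be a logic program over $\Sigma$ and $t\in\mathbf{Term}(\Sigma)$. Then $[t]\to_P^n[\,]$ for some $n\in\mathbb{N}$ if and only if $\mathrm{rew}(P,?\gets t,\mathit{id})$ is an inductive success tree.
   Context: Terms are finite first-order terms with variables over a signature $\Sigma$. A clause is $A\gets B_0,\ldots,B_m$ (body possibly empty); a goal clause is $?\gets B_0,\ldots,B_m$; a logic program $P$ is a finite list $P(0),\ldots,P(k)$ of non-goal clauses, viewed as functions on $\{\epsilon,0,\ldots,m\}$ with $C(\epsilon)$ the head and $C(j)=B_j$. $s\prec_\theta u$ means $\theta$ is a most general matcher of $s$ against $u$ ($\theta(s)=u$). Clause variables are renamed apart. Rewriting step: $[t_1,\ldots,t_i,\ldots,t_n]\to_P[t_1,\ldots,t_{i-1},\sigma(B_0),\ldots,\sigma(B_m),t_{i+1},\ldots,t_n]$ if $A\gets B_0,\ldots,B_m$ is a clause of $P$ and $A\prec_\sigma t_i$; $\to_P^n$ denotes at most $n$ such steps. Rewriting tree $T=\mathrm{rew}(P,C,\sigma)$ (for a clause $C$ and idempotent finite-codomain substitution $\sigma$; $V_R$ a set of or-node variables): $T(\epsilon)=\sigma(C)$ and $T(i)=\sigma(C(i))$ for body positions $i$ of $C$; each node $w$ of odd length is labelled by a term and, for every clause index $i$ of $P$, has a child $wi$ with $T(wi)=\sigma(\theta(P(i)))$ if $\mathrm{head}(P(i))\prec_\theta T(w)$, and a fresh variable of $V_R$ otherwise; each node of even positive length is a clause or a variable of $V_R$; variable nodes are leaves, and a clause node $\sigma(\theta(P(i)))$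 at $w$ has children $wj$ labelled $\sigma(\theta(P(i)(j)))$ for the body positions $j$ of $P(i)$; no other nodes. Even-depth nodes are or-nodes, odd-depth nodes are and-nodes. A rewriting subtree $T'$ of $T$: contains the root with the same label; whenever it contains an even-depth node $w$ it contains all children of $w$ in $T$ (same labels); whenever it contains an odd-depth node $w$ it contains exactly one child of $w$ in $T$ (same label). An inductive success node is an or-node of $T$ that is a non-variable leaf (a clause with empty body). $T$ is an inductive success tree if it has a finite rewriting subtree all of whose leaves are inductive success nodes of $T$. -}

module Defs where

open import Data.Nat using (ℕ; zero; suc)
open import Data.Bool using (Bool; true; false; not)
open import Data.List using (List; []; _∷_; _++_; _∷ʳ_; length; map; lookup)
import Data.Vec as Vec
open Vec using (Vec)
open import Data.Fin using (Fin)
open import Data.Maybe using (Maybe; just; nothing)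
import Data.Maybe as Maybe
open import Data.Product using (Σ; ∃; ∃-syntax; _×_; _,_)
open import Data.Sum using (_⊎_)
open import Relation.Binary.PropositionalEquality using (_≡_)
open import Relation.Nullary using (¬_)
open import Data.List.Membership.Propositional using (_∈_)

record Signature : Set₁ where
  field
    Sym   : Set
    arity : Sym → ℕ
open Signature public

Var : Set
Var = ℕ

data Term (Sig : Signature) : Set where
  var : Var → Term Sig
  fn  : (f : Sym Sig) → Vec (Term Sig) (arity Sig f) → Term Sig

Subst : Signature → Set
Subst Sig = Var → Term Sig

idSubst : {Sig : Signature} → Subst Sig
idSubst = var

mutual
  sub : {Sig : Signature} → Subst Sig → Term Sig → Term Sig
  sub θ (var x)  = θ x
  sub θ (fn f ts) = fn f (subs θ ts)

  subs : {Sig : Signature} {n : ℕ} → Subst Sig → Vec (Term Sig) n → Vec (Term Sig) n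
  subs θ Vec.[]       = Vec.[]
  subs θ (t Vec.∷ ts) = sub θ t Vec.∷ subs θ ts

Matches : {Sig : Signature} → Subst Sig → Term Sig → Term Sig → Set
Matches θ s u = sub θ s ≡ u

MoreGeneral : {Sig : Signature} → Subst Sig → Subst Sig → Set
MoreGeneral {Sig} θ θ' = ∃[ δ ] (∀ (x : Var) → θ' x ≡ sub δ (θ x))

_≺[_]_ : {Sig : Signature} → Term Sig → Subst Sig → Term Sig → Set
s ≺[ θ ] u = Matches θ s u × (∀ θ' → Matches θ' s u → MoreGeneral θ θ')

record PClause (Sig : Signature) : Set where
  constructor _⇐_
  field
    head : Term Sig
    body : List (Term Sig)
open PClause public

-- heads of general clauses: either the goal marker ? or an atom
data Head (Sig : Signature) : Set where
  goalHead : Head Sig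
  atomHead : Term Sig → Head Sig

record Clause (Sig : Signature) : Set where
  constructor mkClause
  field
    chead : Head Sig
    cbody : List (Term Sig)
open Clause public

toClause : {Sig : Signature} → PClause Sig → Clause Sig
toClause (A ⇐ Bs) = mkClause (atomHead A) Bs

goal : {Sig : Signature} → Term Sig → Clause Sig
goal t = mkClause goalHead (t ∷ [])

subHead : {Sig : Signature} → Subst Sig → Head Sig → Head Sig
subHead θ goalHead     = goalHead
subHead θ (atomHead A) = atomHead (sub θ A)

subClause : {Sig : Signature} → Subst Sig → Clause Sig → Clause Sig
subClause θ (mkClause h bs) = mkClause (subHead θ h) (map (sub θ) bs)

Program : Signature → Set
Program Sig = List (PClause Sig)

_‼_ : {A : Set} → List A → ℕ → Maybe A
[]       ‼ _     = nothing
(x ∷ xs) ‼ zero  = just x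
(x ∷ xs) ‼ suc n = xs ‼ n

data Step {Sig : Signature} (P : Program Sig) :
          List (Term Sig) → List (Term Sig) → Set where
  step : (pre suf : List (Term Sig)) (i : Fin (length P)) (t : Term Sig)
         (σ : Subst Sig) → head (lookup P i) ≺[ σ ] t →
         Step P (pre ++ t ∷ suf) (pre ++ map (sub σ) (body (lookup P i)) ++ suf)

data StepsAtMost {Sig : Signature} (P : Program Sig) :
          ℕ → List (Term Sig) → List (Term Sig) → Set where
  done : ∀ {n ts} → StepsAtMost P n ts ts
  more : ∀ {n ts us vs} → Step P ts us → StepsAtMost P n us vs →
         StepsAtMost P (suc n) ts vs

-- labels: terms (and-nodes), clauses or variables of V_R (or-nodes)
data Label (Sig : Signature) : Set where
  termL   : Term Sig → Label Sig
  clauseL : Clause Sig → Label Sig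
  varL    : Var → Label Sig

-- positions are finite words over ℕ;  w j  is  w ∷ʳ j
Pos : Set
Pos = List ℕ

-- a (possibly infinite) labelled tree, as a partial map on positions
Tree : Signature → Set
Tree Sig = Pos → Maybe (Label Sig)

even : ℕ → Bool
even zero    = true
even (suc n) = not (even n)

AndChild : {Sig : Signature} → Subst Sig → Tree Sig → Term Sig → Pos →
           Maybe (PClause Sig) → Set
AndChild σ T u v nothing  = T v ≡ nothing
AndChild σ T u v (just D) =
  (∃[ θ ] (head D ≺[ θ ] u ×
           T v ≡ just (clauseL (subClause σ (subClause θ (toClause D))))))
  ⊎ ((¬ (∃[ θ ] (head D ≺[ θ ] u))) × ∃[ x ] (T v ≡ just (varL x)))

-- T is (a choice of) the rewriting tree rew(P, C, σ)
record IsRewTree {Sig : Signature} (P : Program Sig) (C : Clause Sig)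
                 (σ : Subst Sig) (T : Tree Sig) : Set where
  field
    root      : T [] ≡ just (clauseL (subClause σ C))
    clauseKids : ∀ w c → T w ≡ just (clauseL c) →
                 ∀ j → T (w ∷ʳ j) ≡ Maybe.map termL (cbody c ‼ j)
    termKids  : ∀ w u → T w ≡ just (termL u) →
                ∀ i → AndChild σ T u (w ∷ʳ i) (P ‼ i)
    varLeaf   : ∀ w x → T w ≡ just (varL x) → ∀ j → T (w ∷ʳ j) ≡ nothing
    noOther   : ∀ w → T w ≡ nothing → ∀ j → T (w ∷ʳ j) ≡ nothing

-- a rewriting subtree, given by its set S of positions (labels as in T)
record RewSubtree {Sig : Signature} (T : Tree Sig) (S : Pos → Set) : Set where
  field
    hasRoot : S []
    inT     : ∀ w → S w → ∃[ l ] (T w ≡ just l)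
    prefix  : ∀ w j → S (w ∷ʳ j) → S w
    orAll   : ∀ w → even (length w) ≡ true → S w →
              ∀ j l → T (w ∷ʳ j) ≡ just l → S (w ∷ʳ j)
    andOne  : ∀ w → even (length w) ≡ false → S w →
              ∃[ j ] (S (w ∷ʳ j) × (∀ k → S (w ∷ʳ k) → k ≡ j))

FiniteSet : (Pos → Set) → Set
FiniteSet S = ∃[ L ] (∀ w → S w → w ∈ L)

InductiveSuccessNode : {Sig : Signature} → Tree Sig → Pos → Set
InductiveSuccessNode T w =
  even (length w) ≡ true ×
  ∃[ c ] (T w ≡ just (clauseL c) × (∀ j → T (w ∷ʳ j) ≡ nothing))

IsInductiveSuccessTree : {Sig : Signature} → Tree Sig → Set₁
IsInductiveSuccessTree T =
  ∃[ S ] (RewSubtree T S × FiniteSet S ×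
          (∀ w → S w → (∀ j → ¬ S (w ∷ʳ j)) → InductiveSuccessNode T w))

module Submission where

-- Both sides are compared with an inductive notion of derivation.  An atom u is
-- `Solved` when some clause of P has a head matching u with a most general
-- matcher σ and every atom of σ(body) is Solved.
--  * Rewriting [t] to [ ] is the same as a derivation of t: derivations are
--    flattened leftmost-first into rewriting steps, and conversely every step
--    of a successful sequence solves the atom it rewrites.
--  * An inductive success tree is the same as an inductive witness `OrProof`
--    that the root of the tree succeeds.  A witness determines a finite
--    rewriting subtree (the positions it visits) whose leaves are empty clause
--    bodies; a finite such subtree has bounded depth, so a witness is read off
--    it by induction on the remaining height.
--  * Witnesses on the tree and derivations agree.  The tree uses its own most
--    general matchers, which differ from those of a derivation only up to
--    instantiation; three facts (E), (F), (G) about most general matchers let a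
--    derivation follow the tree through instances of its atoms.

open import Defs
open import Data.Nat using (ℕ; zero; suc; _+_; _∸_; _≤_; _<_; _≤?_; _≟_; s≤s)
open import Data.Nat.Properties using (m≤m+n; m+n∸m≡n; <⇒≱; n≮n; +-assoc; +-comm; +-identityʳ; ≤-refl)
open import Data.List using (List; []; _∷_; _++_; _∷ʳ_; map; length; lookup)
open import Data.List.Properties using (map-id; map-cong; length-++; ++-identityʳ; ∷ʳ-++)
open import Data.List.Extrema.Nat using (max; xs≤max)
open import Data.List.Membership.Propositional using (_∈_; _∉_)
open import Data.List.Membership.Propositional.Properties using (∈-map⁺; ∈-++⁺ˡ; ∈-++⁺ʳ; ∈-++⁻)
open import Data.List.Membership.DecPropositional _≟_ using (_∈?_)
open import Data.List.Relation.Unary.Any using (here; there)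
open import Data.List.Relation.Unary.All using (All; []; _∷_)
import Data.List.Relation.Unary.All as All
import Data.List.Relation.Unary.All.Properties as All
import Data.Vec as V
open V using (Vec)
open import Data.Vec.Properties using (∷-injective)
open import Data.Product using (∃-syntax; _×_; _,_; proj₁; proj₂)
open import Data.Sum using (inj₁; inj₂)
open import Data.Empty using (⊥; ⊥-elim)
open import Data.Unit using (⊤; tt)
open import Data.Bool using (Bool; true; false; not)
open import Data.Bool.Properties using (not-involutive)
open import Relation.Nullary using (¬_; yes; no)
open import Relation.Binary.PropositionalEquality
open import Function using (case_of_)
open import Function.Bundles using (_⇔_; mk⇔)
open import Function.Construct.Composition using (_⇔-∘_)
open import Data.Fin as Fin using (Fin; toℕ)
open import Data.Maybe using (Maybe; just; nothing)
import Data.Maybe as Maybe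

module Substitution {Sig : Signature} where

  mutual
    sub-id : (t : Term Sig) → sub idSubst t ≡ t
    sub-id (var x)   = refl
    sub-id (fn f ts) = cong (fn f) (subs-id ts)

    subs-id : ∀ {n} (ts : Vec (Term Sig) n) → subs idSubst ts ≡ ts
    subs-id V.[]       = refl
    subs-id (t V.∷ ts) = cong₂ V._∷_ (sub-id t) (subs-id ts)

  map-sub-id : (ts : List (Term Sig)) → map (sub idSubst) ts ≡ ts
  map-sub-id ts = trans (map-cong sub-id ts) (map-id ts)

  _∘ˢ_ : Subst Sig → Subst Sig → Subst Sig
  (δ ∘ˢ σ) x = sub δ (σ x)

  mutual
    sub-∘ : ∀ δ σ (t : Term Sig) → sub δ (sub σ t) ≡ sub (δ ∘ˢ σ) t
    sub-∘ δ σ (var x)   = refl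
    sub-∘ δ σ (fn f ts) = cong (fn f) (subs-∘ δ σ ts)

    subs-∘ : ∀ δ σ {n} (ts : Vec (Term Sig) n) → subs δ (subs σ ts) ≡ subs (δ ∘ˢ σ) ts
    subs-∘ δ σ V.[]       = refl
    subs-∘ δ σ (t V.∷ ts) = cong₂ V._∷_ (sub-∘ δ σ t) (subs-∘ δ σ ts)

  mutual
    vars : Term Sig → List Var
    vars (var x)   = x ∷ []
    vars (fn f ts) = varsᵛ ts

    varsᵛ : ∀ {n} → Vec (Term Sig) n → List Var
    varsᵛ V.[]       = []
    varsᵛ (t V.∷ ts) = vars t ++ varsᵛ ts

  mutual
    sub-agree : ∀ σ τ (t : Term Sig) → (∀ x → x ∈ vars t → σ x ≡ τ x) → sub σ t ≡ sub τ t
    sub-agree σ τ (var x)   h = h x (here refl)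
    sub-agree σ τ (fn f ts) h = cong (fn f) (subs-agree σ τ ts h)

    subs-agree : ∀ σ τ {n} (ts : Vec (Term Sig) n) → (∀ x → x ∈ varsᵛ ts → σ x ≡ τ x) →
                 subs σ ts ≡ subs τ ts
    subs-agree σ τ V.[]       h = refl
    subs-agree σ τ (t V.∷ ts) h =
      cong₂ V._∷_ (sub-agree σ τ t (λ x x∈ → h x (∈-++⁺ˡ x∈)))
                  (subs-agree σ τ ts (λ x x∈ → h x (∈-++⁺ʳ (vars t) x∈)))

  mutual
    agree-sub : ∀ σ τ (t : Term Sig) → sub σ t ≡ sub τ t → ∀ x → x ∈ vars t → σ x ≡ τ x
    agree-sub σ τ (var y)   eq x (here refl) = eq
    agree-sub σ τ (fn f ts) eq x x∈          = agree-subs σ τ ts (fn-injective eq) x x∈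
      where
      fn-injective : ∀ {f} {us vs : Vec (Term Sig) (arity Sig f)} → fn f us ≡ fn f vs → us ≡ vs
      fn-injective refl = refl

    agree-subs : ∀ σ τ {n} (ts : Vec (Term Sig) n) → subs σ ts ≡ subs τ ts →
                 ∀ x → x ∈ varsᵛ ts → σ x ≡ τ x
    agree-subs σ τ (t V.∷ ts) eq x x∈ with ∷-injective eq | ∈-++⁻ (vars t) x∈
    ... | eq₁ , _   | inj₁ x∈t  = agree-sub σ τ t eq₁ x x∈t
    ... | _   , eq₂ | inj₂ x∈ts = agree-subs σ τ ts eq₂ x x∈ts

  mutual
    vars-sub⁻ : ∀ σ (t : Term Sig) {v} → v ∈ vars (sub σ t) → ∃[ y ] (y ∈ vars t × v ∈ vars (σ y))
    vars-sub⁻ σ (var y)   v∈ = y , here refl , v∈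
    vars-sub⁻ σ (fn f ts) v∈ = varsᵛ-sub⁻ σ ts v∈

    varsᵛ-sub⁻ : ∀ σ {n} (ts : Vec (Term Sig) n) {v} → v ∈ varsᵛ (subs σ ts) →
                 ∃[ y ] (y ∈ varsᵛ ts × v ∈ vars (σ y))
    varsᵛ-sub⁻ σ (t V.∷ ts) v∈ with ∈-++⁻ (vars (sub σ t)) v∈
    ... | inj₁ v∈t  = let y , y∈ , v∈σy = vars-sub⁻ σ t v∈t in y , ∈-++⁺ˡ y∈ , v∈σy
    ... | inj₂ v∈ts = let y , y∈ , v∈σy = varsᵛ-sub⁻ σ ts v∈ts in y , ∈-++⁺ʳ (vars t) y∈ , v∈σy

  mutual
    vars-sub⁺ : ∀ σ (t : Term Sig) {y v} → y ∈ vars t → v ∈ vars (σ y) → v ∈ vars (sub σ t)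
    vars-sub⁺ σ (var y)   (here refl) v∈ = v∈
    vars-sub⁺ σ (fn f ts) y∈          v∈ = varsᵛ-sub⁺ σ ts y∈ v∈

    varsᵛ-sub⁺ : ∀ σ {n} (ts : Vec (Term Sig) n) {y v} → y ∈ varsᵛ ts → v ∈ vars (σ y) →
                 v ∈ varsᵛ (subs σ ts)
    varsᵛ-sub⁺ σ (t V.∷ ts) y∈ v∈ with ∈-++⁻ (vars t) y∈
    ... | inj₁ y∈t  = ∈-++⁺ˡ (vars-sub⁺ σ t y∈t v∈)
    ... | inj₂ y∈ts = ∈-++⁺ʳ (vars (sub σ t)) (varsᵛ-sub⁺ σ ts y∈ts v∈)

  fixes-vars : ∀ ε (t : Term Sig) → sub ε t ≡ t → ∀ v → v ∈ vars t → ε v ≡ var v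
  fixes-vars ε t eq = agree-sub ε var t (trans eq (sym (sub-id t)))

  fresh : List Var → Var
  fresh xs = suc (max 0 xs)

  <fresh : ∀ {xs v} → v ∈ xs → v < fresh xs
  <fresh v∈ = s≤s (All.lookup (xs≤max 0 _) v∈)

  pick : List Var → Subst Sig → Subst Sig → Subst Sig
  pick xs σ τ y with y ∈? xs
  ... | yes _ = σ y
  ... | no  _ = τ y

  pick-in : ∀ xs σ τ {y} → y ∈ xs → pick xs σ τ y ≡ σ y
  pick-in xs σ τ {y} y∈ with y ∈? xs
  ... | yes _  = refl
  ... | no y∉ = ⊥-elim (y∉ y∈)

  pick-out : ∀ xs σ τ {y} → y ∉ xs → pick xs σ τ y ≡ τ y
  pick-out xs σ τ {y} y∉ with y ∈? xs
  ... | yes y∈ = ⊥-elim (y∉ y∈)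
  ... | no _   = refl

  unshift : ℕ → Subst Sig → Subst Sig
  unshift N θ v with N ≤? v
  ... | yes _ = θ (v ∸ N)
  ... | no  _ = var v

  unshift-low : ∀ N θ {v} → v < N → unshift N θ v ≡ var v
  unshift-low N θ {v} v<N with N ≤? v
  ... | yes N≤v = ⊥-elim (<⇒≱ v<N N≤v)
  ... | no _    = refl

  unshift-high : ∀ N θ y → unshift N θ (N + y) ≡ θ y
  unshift-high N θ y with N ≤? N + y
  ... | yes _   = cong θ (m+n∸m≡n N y)
  ... | no N≰ = ⊥-elim (N≰ (m≤m+n N y))

  -- (E) if s matches u = m(s) at all, it has a most general matcher: agree with m on
  -- the variables of s and send every other variable y to the fresh variable N + y
  mgm-exists : ∀ s (m : Subst Sig) → ∃[ θ ] (s ≺[ θ ] sub m s)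
  mgm-exists s m = θ , θ-matches , θ-general
    where
    N : Var
    N = fresh (vars (sub m s))
    θ : Subst Sig
    θ = pick (vars s) m (λ y → var (N + y))

    θ-matches : sub θ s ≡ sub m s
    θ-matches = sub-agree θ m s (λ y y∈ → pick-in (vars s) m _ y∈)

    θ-general : ∀ θ' → Matches θ' s (sub m s) → MoreGeneral θ θ'
    θ-general θ' θ's≡ms = unshift N θ' , factor
      where
      factor : ∀ y → θ' y ≡ sub (unshift N θ') (θ y)
      factor y = case y ∈? vars s of λ { (yes y∈) → on-s y∈ ; (no y∉) → off-s y∉ }
        where
        on-s : y ∈ vars s → θ' y ≡ sub (unshift N θ') (θ y)
        on-s y∈ = begin
          θ' y                           ≡⟨ agree-sub θ' m s θ's≡ms y y∈ ⟩
          m y                            ≡⟨ sub-id (m y) ⟨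
          sub var (m y)                  ≡⟨ sub-agree var (unshift N θ') (m y) low ⟩
          sub (unshift N θ') (m y)       ≡⟨ cong (sub (unshift N θ')) (pick-in (vars s) m _ y∈) ⟨
          sub (unshift N θ') (θ y)       ∎
          where
          open ≡-Reasoning
          low : ∀ v → v ∈ vars (m y) → var v ≡ unshift N θ' v
          low v v∈ = sym (unshift-low N θ' (<fresh (vars-sub⁺ m s y∈ v∈)))

        off-s : y ∉ vars s → θ' y ≡ sub (unshift N θ') (θ y)
        off-s y∉ = trans (sym (unshift-high N θ' y))
                         (cong (sub (unshift N θ')) (sym (pick-out (vars s) m _ y∉)))

  -- (F) a most general matcher of s against u sends each variable outside s to a
  -- variable not occurring in u
  mgm-fresh : ∀ {s σ u} → s ≺[ σ ] u → ∀ x → x ∉ vars s → ∃[ v ] (σ x ≡ var v × v ∉ vars u)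
  mgm-fresh {s} {σ} {u} (σs≡u , σ-general) x x∉s = v , σx≡v , v∉u
    where
    N : Var
    N = fresh (vars u)
    -- σ with x redirected to the fresh variable N
    m : Subst Sig
    m = pick (x ∷ []) (λ _ → var N) σ

    m≡σ : ∀ {y} → y ∈ vars s → m y ≡ σ y
    m≡σ y∈ = pick-out (x ∷ []) _ σ λ { (here refl) → x∉s y∈ }

    factor : MoreGeneral σ m
    factor = σ-general m (trans (sub-agree m σ s (λ _ → m≡σ)) σs≡u)
    ε : Subst Sig
    ε = proj₁ factor

    -- ε(σ(x)) = m(x) = N forces σ(x) to be a variable v with ε(v) = N
    σx-var : ∀ t → var N ≡ sub ε t → ∃[ v ] (t ≡ var v × ε v ≡ var N)
    σx-var (var v)   eq = v , refl , sym eq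
    σx-var (fn f ts) ()

    shape : ∃[ v ] (σ x ≡ var v × ε v ≡ var N)
    shape = σx-var (σ x) (trans (sym (pick-in (x ∷ []) _ σ (here refl))) (proj₂ factor x))
    v : Var
    v = proj₁ shape
    σx≡v : σ x ≡ var v
    σx≡v = proj₁ (proj₂ shape)

    -- ε fixes every variable of u = σ(s), but maps v to the fresh N
    v∉u : v ∉ vars u
    v∉u v∈u with vars-sub⁻ σ s (subst (λ w → v ∈ vars w) (sym σs≡u) v∈u)
    ... | y , y∈ , v∈σy = n≮n N (subst (_< N) v≡N (<fresh v∈u))
      where
      εv≡v : ε v ≡ var v
      εv≡v = fixes-vars ε (σ y) (trans (sym (proj₂ factor y)) (m≡σ y∈)) v v∈σy
      var-injective : ∀ {a b} → _≡_ {A = Term Sig} (var a) (var b) → a ≡ b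
      var-injective refl = refl
      v≡N : v ≡ N
      v≡N = var-injective (trans (sym εv≡v) (proj₂ (proj₂ shape)))

  -- (G) any matcher θ of s against an instance δ(u) factors through a most general
  -- matcher σ of s against u
  mgm-factors : ∀ {s σ u} → s ≺[ σ ] u → ∀ θ δ → Matches θ s (sub δ u) →
                ∃[ γ ] (∀ x → sub γ (σ x) ≡ θ x)
  mgm-factors {s} {σ} {u} mgm@(σs≡u , σ-general) θ δ θs≡δu = γ , factor
    where
    -- σ on s and θ off s: again a matcher of s against u, hence of the form ε ∘ σ
    m : Subst Sig
    m = pick (vars s) σ θ
    m-factor : MoreGeneral σ m
    m-factor = σ-general m (trans (sub-agree m σ s (λ _ → pick-in (vars s) σ θ)) σs≡u)
    ε : Subst Sig
    ε = proj₁ m-factor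
    γ : Subst Sig
    γ = pick (vars u) δ ε

    factor : ∀ x → sub γ (σ x) ≡ θ x
    factor x with x ∈? vars s
    ... | yes x∈ = trans (sub-agree γ δ (σ x) on-u) (agree-sub (δ ∘ˢ σ) θ s δσs≡θs x x∈)
      where
      on-u : ∀ v → v ∈ vars (σ x) → γ v ≡ δ v
      on-u v v∈ = pick-in (vars u) δ ε (subst (λ w → v ∈ vars w) σs≡u (vars-sub⁺ σ s x∈ v∈))
      δσs≡θs : sub (δ ∘ˢ σ) s ≡ sub θ s
      δσs≡θs = trans (sym (sub-∘ δ σ s)) (trans (cong (sub δ) σs≡u) (sym θs≡δu))
    ... | no x∉ with mgm-fresh {s} {σ} {u} mgm x x∉
    ...   | v , σx≡v , v∉u = begin
      sub γ (σ x)   ≡⟨ cong (sub γ) σx≡v ⟩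
      γ v           ≡⟨ pick-out (vars u) δ ε v∉u ⟩
      ε v           ≡⟨ cong (sub ε) σx≡v ⟨
      sub ε (σ x)   ≡⟨ proj₂ m-factor x ⟨
      m x           ≡⟨ pick-out (vars s) σ θ x∉ ⟩
      θ x           ∎
      where open ≡-Reasoning

  sub-factor : ∀ {γ σ θ} → (∀ x → sub γ (σ x) ≡ θ x) → ∀ b → sub γ (sub σ b) ≡ sub idSubst (sub θ b)
  sub-factor {γ} {σ} {θ} factor b =
    trans (sub-∘ γ σ b) (trans (sub-agree (γ ∘ˢ σ) θ b (λ x _ → factor x)) (sym (sub-id (sub θ b))))

  instance-matchable : ∀ {s σ u} → s ≺[ σ ] u → ∀ δ → ∃[ θ ] (s ≺[ θ ] sub δ u)
  instance-matchable {s} {σ} {u} (σs≡u , _) δ =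
    subst (λ w → ∃[ θ ] (s ≺[ θ ] w)) (trans (sym (sub-∘ δ σ s)) (cong (sub δ) σs≡u))
          (mgm-exists s (δ ∘ˢ σ))

module Derivations {Sig : Signature} (P : Program Sig) where

  data Solved : Term Sig → Set where
    resolve : ∀ {u D} (j : ℕ) → P ‼ j ≡ just D → (σ : Subst Sig) → head D ≺[ σ ] u →
              All Solved (map (sub σ) (body D)) → Solved u

  Solvable : List (Term Sig) → Set
  Solvable ts = ∃[ n ] StepsAtMost P n ts []

  -- clause indices as natural numbers (trees) versus Fin (rewriting steps)
  ‼⇒lookup : ∀ {A : Set} (xs : List A) j {x} → xs ‼ j ≡ just x → ∃[ i ] (lookup xs i ≡ x)
  ‼⇒lookup (y ∷ xs) zero    refl = Fin.zero , refl
  ‼⇒lookup (y ∷ xs) (suc j) eq   = let i , eqᵢ = ‼⇒lookup xs j eq in Fin.suc i , eqᵢ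

  lookup⇒‼ : ∀ {A : Set} (xs : List A) (i : Fin (length xs)) → xs ‼ toℕ i ≡ just (lookup xs i)
  lookup⇒‼ (x ∷ xs) Fin.zero    = refl
  lookup⇒‼ (x ∷ xs) (Fin.suc i) = lookup⇒‼ xs i

  -- a rewriting sequence ending in [] solves each atom of the start: the atom
  -- rewritten by the first step is solved by the clause used there
  solvable⇒solved : ∀ {n ts} → StepsAtMost P n ts [] → All Solved ts
  solvable⇒solved done = []
  solvable⇒solved (more (step pre suf i t σ mgm) rest)
    with All.++⁻ pre (solvable⇒solved rest)
  ... | solvedPre , solvedBodySuf with All.++⁻ (map (sub σ) (body (lookup P i))) solvedBodySuf
  ...   | solvedBody , solvedSuf =
    All.++⁺ solvedPre (resolve (toℕ i) (lookup⇒‼ P i) σ mgm solvedBody ∷ solvedSuf)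

  mutual
    -- conversely, solutions of the atoms give a rewriting sequence, leftmost atom first
    solved⇒solvable : ∀ {t ts} → Solved t → Solvable ts → Solvable (t ∷ ts)
    solved⇒solvable {t} {ts} (resolve j eD σ mgm solvedBody) rest with ‼⇒lookup P j eD
    ... | i , refl = let n , steps = all⇒solvable solvedBody rest
                     in suc n , more (step [] ts i t σ mgm) steps

    all⇒solvable : ∀ {bs ts} → All Solved bs → Solvable ts → Solvable (bs ++ ts)
    all⇒solvable []       rest = rest
    all⇒solvable (s ∷ ss) rest = solved⇒solvable s (all⇒solvable ss rest)

  solvable⇔solved : ∀ t → Solvable (t ∷ []) ⇔ Solved t
  solvable⇔solved t = mk⇔ (λ (_ , steps) → All.head (solvable⇒solved steps))
                          (λ s → solved⇒solvable s (0 , done))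

-- The subtree below a child of the root again
-- obeys the laws of a rewriting tree (except for its root label), so the tree
-- arguments recurse from the root downwards on cons-built positions.
module Trees {Sig : Signature} (P : Program Sig) where
  open Substitution {Sig}
  open Derivations P

  _↓_ : Tree Sig → ℕ → Tree Sig
  (T ↓ k) r = T (k ∷ r)

  _↾_ : Tree Sig → Pos → Tree Sig
  (T ↾ x) r = T (x ++ r)

  resolvent : Subst Sig → PClause Sig → Clause Sig
  resolvent θ D = subClause idSubst (subClause θ (toClause D))

  -- the laws of rew(P, C, id) that do not mention the root
  record RewLaws (T : Tree Sig) : Set where
    field
      clauseKids : ∀ w c → T w ≡ just (clauseL c) →
                   ∀ j → T (w ∷ʳ j) ≡ Maybe.map termL (cbody c ‼ j)
      termKids   : ∀ w u → T w ≡ just (termL u) → ∀ i → AndChild idSubst T u (w ∷ʳ i) (P ‼ i)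
      varLeaf    : ∀ w x → T w ≡ just (varL x) → ∀ j → T (w ∷ʳ j) ≡ nothing

  rewLaws : ∀ {C T} → IsRewTree P C idSubst T → RewLaws T
  rewLaws isRew = record { clauseKids = clauseKids ; termKids = termKids ; varLeaf = varLeaf }
    where open IsRewTree isRew

  laws-↓ : ∀ {T} → RewLaws T → ∀ k → RewLaws (T ↓ k)
  laws-↓ laws k = record
    { clauseKids = λ w → clauseKids (k ∷ w)
    ; termKids   = λ w u tu i → shift (P ‼ i) (termKids (k ∷ w) u tu i)
    ; varLeaf    = λ w → varLeaf (k ∷ w)
    }
    where
    open RewLaws laws
    shift : ∀ {T u v} mD → AndChild idSubst T u (k ∷ v) mD → AndChild idSubst (T ↓ k) u v mD
    shift nothing  child = child
    shift (just D) child = child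

  mutual
    data OrProof (T : Tree Sig) : Set where
      orProof : (c : Clause Sig) → T [] ≡ just (clauseL c) → KidProofs (T ↓_) (cbody c) → OrProof T

    data AndProof (T : Tree Sig) (u : Term Sig) : Set where
      andProof : T [] ≡ just (termL u) → (j : ℕ) → OrProof (T ↓ j) → AndProof T u

    data KidProofs : (ℕ → Tree Sig) → List (Term Sig) → Set where
      []  : ∀ {F} → KidProofs F []
      _∷_ : ∀ {F b bs} → AndProof (F 0) b → KidProofs (λ k → F (suc k)) bs → KidProofs F (b ∷ bs)

  tabulateKids : ∀ {F} bs → (∀ k {b} → bs ‼ k ≡ just b → AndProof (F k) b) → KidProofs F bs
  tabulateKids []       kid = []
  tabulateKids (b ∷ bs) kid = kid 0 refl ∷ tabulateKids bs (λ k → kid (suc k))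

  -- The positions (relative to the root) of the rewriting subtree a proof describes.
  mutual
    OnOr : ∀ {T} → OrProof T → Pos → Set
    OnOr (orProof c tc κ) []      = ⊤
    OnOr (orProof c tc κ) (k ∷ r) = OnKid κ k r

    OnAnd : ∀ {T u} → AndProof T u → Pos → Set
    OnAnd (andProof tu j π) []      = ⊤
    OnAnd (andProof tu j π) (k ∷ r) = k ≡ j × OnOr π r

    OnKid : ∀ {F bs} → KidProofs F bs → ℕ → Pos → Set
    OnKid []      k       r = ⊥
    OnKid (α ∷ κ) zero    r = OnAnd α r
    OnKid (α ∷ κ) (suc k) r = OnKid κ k r

  onKid-root : ∀ {F bs} (κ : KidProofs F bs) j {b} → bs ‼ j ≡ just b → OnKid κ j []
  onKid-root (α ∷ κ) zero    refl = onAnd-root α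
    where
    onAnd-root : ∀ {T u} (α : AndProof T u) → OnAnd α []
    onAnd-root (andProof _ _ _) = tt
  onKid-root (α ∷ κ) (suc j) eb   = onKid-root κ j eb

  onOr-root : ∀ {T} (π : OrProof T) → OnOr π []
  onOr-root (orProof _ _ _) = tt

  data NodeView (T : Tree Sig) (On : Pos → Set) (b : Bool) (r : Pos) : Set where
    orNode  : (c : Clause Sig) → T r ≡ just (clauseL c) → even (length r) ≡ b →
              (∀ j {a} → cbody c ‼ j ≡ just a → On (r ∷ʳ j)) → NodeView T On b r
    andNode : (u : Term Sig) → T r ≡ just (termL u) → even (length r) ≡ not b →
              (j : ℕ) → On (r ∷ʳ j) → (∀ k → On (r ∷ʳ k) → k ≡ j) → NodeView T On b r

  view-↓ : ∀ {T On On' b k r} → (∀ r → On' r → On (k ∷ r)) → (∀ r → On (k ∷ r) → On' r) →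
           NodeView (T ↓ k) On' (not b) r → NodeView T On b (k ∷ r)
  view-↓ {b = b} into back (orNode c tc parity kids) =
    orNode c tc (trans (cong not parity) (not-involutive b)) (λ j ea → into _ (kids j ea))
  view-↓ {b = b} into back (andNode u tu parity j on unique) =
    andNode u tu (trans (cong not parity) (not-involutive (not b))) j (into _ on)
            (λ k onₖ → unique k (back _ onₖ))

  mutual
    viewOr : ∀ {T} (π : OrProof T) r → OnOr π r → NodeView T (OnOr π) true r
    viewOr (orProof c tc κ) []      _  = orNode c tc refl (onKid-root κ)
    viewOr (orProof c tc κ) (k ∷ r) on = view-↓ (λ _ x → x) (λ _ x → x) (viewKid κ k r on)

    viewAnd : ∀ {T u} (α : AndProof T u) r → OnAnd α r → NodeView T (OnAnd α) false r
    viewAnd (andProof tu j π) []      _         = andNode _ tu refl j (refl , onOr-root π) (λ k on → proj₁ on)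
    viewAnd (andProof tu j π) (k ∷ r) (refl , on) =
      view-↓ (λ _ on → refl , on) (λ _ on → proj₂ on) (viewOr π r on)

    viewKid : ∀ {F bs} (κ : KidProofs F bs) k r → OnKid κ k r → NodeView (F k) (OnKid κ k) false r
    viewKid (α ∷ κ) zero    r on = viewAnd α r on
    viewKid (α ∷ κ) (suc k) r on = viewKid κ k r on

  mutual
    prefixOr : ∀ {T} (π : OrProof T) r j → OnOr π (r ∷ʳ j) → OnOr π r
    prefixOr (orProof c tc κ) []      j _  = tt
    prefixOr (orProof c tc κ) (k ∷ r) j on = prefixKid κ k r j on

    prefixAnd : ∀ {T u} (α : AndProof T u) r j → OnAnd α (r ∷ʳ j) → OnAnd α r
    prefixAnd (andProof tu i π) []      j _         = tt
    prefixAnd (andProof tu i π) (k ∷ r) j (k≡i , on) = k≡i , prefixOr π r j on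

    prefixKid : ∀ {F bs} (κ : KidProofs F bs) k r j → OnKid κ k (r ∷ʳ j) → OnKid κ k r
    prefixKid (α ∷ κ) zero    r j on = prefixAnd α r j on
    prefixKid (α ∷ κ) (suc k) r j on = prefixKid κ k r j on

  mutual
    pathsOr : ∀ {T} → OrProof T → List Pos
    pathsOr (orProof c tc κ) = [] ∷ pathsKid κ

    pathsAnd : ∀ {T u} → AndProof T u → List Pos
    pathsAnd (andProof tu j π) = [] ∷ map (j ∷_) (pathsOr π)

    pathsKid : ∀ {F bs} → KidProofs F bs → List Pos
    pathsKid []      = []
    pathsKid (α ∷ κ) = map (0 ∷_) (pathsAnd α) ++ map nextKid (pathsKid κ)
      where
      nextKid : Pos → Pos
      nextKid []      = []
      nextKid (k ∷ r) = suc k ∷ r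

  mutual
    ∈pathsOr : ∀ {T} (π : OrProof T) r → OnOr π r → r ∈ pathsOr π
    ∈pathsOr (orProof c tc κ) []      _  = here refl
    ∈pathsOr (orProof c tc κ) (k ∷ r) on = there (∈pathsKid κ k r on)

    ∈pathsAnd : ∀ {T u} (α : AndProof T u) r → OnAnd α r → r ∈ pathsAnd α
    ∈pathsAnd (andProof tu j π) []      _         = here refl
    ∈pathsAnd (andProof tu j π) (k ∷ r) (refl , on) = there (∈-map⁺ (j ∷_) (∈pathsOr π r on))

    ∈pathsKid : ∀ {F bs} (κ : KidProofs F bs) k r → OnKid κ k r → (k ∷ r) ∈ pathsKid κ
    ∈pathsKid (α ∷ κ) zero    r on = ∈-++⁺ˡ (∈-map⁺ (0 ∷_) (∈pathsAnd α r on))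
    ∈pathsKid (α ∷ κ) (suc k) r on = ∈-++⁺ʳ _ (∈-map⁺ _ (∈pathsKid κ k r on))

  map-just : ∀ {A B : Set} {f : A → B} (m : Maybe A) {y} → Maybe.map f m ≡ just y → ∃[ x ] (m ≡ just x)
  map-just (just x) _ = x , refl

  parity-clash : ∀ {b} → b ≡ true → b ≡ false → ⊥
  parity-clash refl ()

  proof⇒success : ∀ {T} → RewLaws T → OrProof T → IsInductiveSuccessTree T
  proof⇒success {T} laws π = OnOr π , subtree , (pathsOr π , ∈pathsOr π) , leaves
    where
    open RewLaws laws

    labelled : ∀ w → OnOr π w → ∃[ l ] (T w ≡ just l)
    labelled w on with viewOr π w on
    ... | orNode c tc _ _      = clauseL c , tc
    ... | andNode u tu _ _ _ _ = termL u , tu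

    orAll : ∀ w → even (length w) ≡ true → OnOr π w → ∀ j l → T (w ∷ʳ j) ≡ just l → OnOr π (w ∷ʳ j)
    orAll w isEven on j l tl with viewOr π w on
    ... | orNode c tc _ kids      = kids j (proj₂ (map-just _ (trans (sym (clauseKids w c tc j)) tl)))
    ... | andNode _ _ isOdd _ _ _ = ⊥-elim (parity-clash isEven isOdd)

    andOne : ∀ w → even (length w) ≡ false → OnOr π w →
             ∃[ j ] (OnOr π (w ∷ʳ j) × (∀ k → OnOr π (w ∷ʳ k) → k ≡ j))
    andOne w isOdd on with viewOr π w on
    ... | orNode _ _ isEven _        = ⊥-elim (parity-clash isEven isOdd)
    ... | andNode _ _ _ j onⱼ unique = j , onⱼ , unique

    subtree : RewSubtree T (OnOr π)
    subtree = record { hasRoot = onOr-root π ; inT = labelled ; prefix = prefixOr π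
                     ; orAll = orAll ; andOne = andOne }

    leaves : ∀ w → OnOr π w → (∀ j → ¬ OnOr π (w ∷ʳ j)) → InductiveSuccessNode T w
    leaves w on noKid with viewOr π w on
    ... | andNode _ _ _ j onⱼ _    = ⊥-elim (noKid j onⱼ)
    ... | orNode c tc isEven kids = isEven , c , tc , kidless
      where
      kidless : ∀ j → T (w ∷ʳ j) ≡ nothing
      kidless j with cbody c ‼ j in eb
      ... | just _  = ⊥-elim (noKid j (kids j eb))
      ... | nothing = trans (clauseKids w c tc j) (cong (Maybe.map termL) eb)

  even-∷ʳ : ∀ (x : Pos) k → even (length (x ∷ʳ k)) ≡ not (even (length x))
  even-∷ʳ x k = cong even (trans (length-++ x) (+-comm (length x) 1))

  fuel-∷ʳ : ∀ {B} (x : Pos) k f → B ≤ length x + suc f → B ≤ length (x ∷ʳ k) + f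
  fuel-∷ʳ {B} x k f = subst (B ≤_) (trans (sym (+-assoc (length x) 1 f)) (cong (_+ f) (sym (length-++ x))))

  ↾-∷ʳ : ∀ {T T'} x → T' ≗ T ↾ x → ∀ k → (T' ↓ k) ≗ T ↾ (x ∷ʳ k)
  ↾-∷ʳ {T} x eq k r = trans (eq (k ∷ r)) (cong T (sym (∷ʳ-++ x k r)))

  ↾-root : ∀ {T T'} x → T' ≗ T ↾ x → T' [] ≡ T x
  ↾-root {T} x eq = trans (eq []) (cong T (++-identityʳ x))

  -- (⇐) Given a finite rewriting subtree S whose leaves are inductive success
  -- nodes, read off proofs for all its or- and and-nodes, by induction on the
  -- remaining height B - length x, where B bounds the depth of S.
  module FromSubtree {T : Tree Sig} (laws : RewLaws T) {S : Pos → Set} (subtree : RewSubtree T S)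
                     (B : ℕ) (shallow : ∀ w → S w → length w < B)
                     (leaves : ∀ w → S w → (∀ j → ¬ S (w ∷ʳ j)) → InductiveSuccessNode T w) where
    open RewLaws laws
    open RewSubtree subtree

    unlabelled : ∀ {w} → S w → T w ≡ nothing → ⊥
    unlabelled {w} sw tw with inT w sw
    ... | l , tl with trans (sym tl) tw
    ...   | ()

    -- S has no variable nodes: they would be leaves that are not clause nodes
    noVarNode : ∀ {w x} → S w → T w ≡ just (varL x) → ⊥
    noVarNode {w} {x} sw tw with leaves w sw (λ j sj → unlabelled sj (varLeaf w x tw j))
    ... | _ , c , tc , _ with trans (sym tc) tw
    ...   | ()

    -- hence the child in S of an and-node is a clause node
    andKid-clause : ∀ {w u} j → T w ≡ just (termL u) → S (w ∷ʳ j) → ∃[ c ] (T (w ∷ʳ j) ≡ just (clauseL c))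
    andKid-clause {w} {u} j tw sj with P ‼ j | termKids w u tw j
    ... | nothing | tnone                 = ⊥-elim (unlabelled sj tnone)
    ... | just D  | inj₁ (_ , _ , tc)     = _ , tc
    ... | just D  | inj₂ (_ , _ , tv)     = ⊥-elim (noVarNode sj tv)

    out-of-fuel : ∀ {x} → S x → B ≤ length x + 0 → ⊥
    out-of-fuel {x} sx le = <⇒≱ (shallow x sx) (subst (B ≤_) (+-identityʳ (length x)) le)

    -- the subtree T' of T at the or-node x ∈ S (resp. and-node w ∈ S) succeeds;
    -- the fuel f is enough to reach depth B
    mutual
      orBuild : ∀ f x {c} → B ≤ length x + f → S x → even (length x) ≡ true → T x ≡ just (clauseL c) →
                ∀ T' → T' ≗ T ↾ x → OrProof T'
      orBuild zero    x le sx _ _ _ _ = ⊥-elim (out-of-fuel sx le)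
      orBuild (suc f) x {c} le sx isEven tx T' eq =
        orProof c (trans (↾-root {T} x eq) tx) (tabulateKids (cbody c) kid)
        where
        kid : ∀ k {b} → cbody c ‼ k ≡ just b → AndProof (T' ↓ k) b
        kid k {b} eb = andBuild f (x ∷ʳ k) (fuel-∷ʳ x k f le) (orAll x isEven sx k _ tk)
                            (trans (even-∷ʳ x k) (cong not isEven)) tk (T' ↓ k) (↾-∷ʳ {T} x eq k)
          where
          tk : T (x ∷ʳ k) ≡ just (termL b)
          tk = trans (clauseKids x c tx k) (cong (Maybe.map termL) eb)

      andBuild : ∀ f w {u} → B ≤ length w + f → S w → even (length w) ≡ false → T w ≡ just (termL u) →
                 ∀ T' → T' ≗ T ↾ w → AndProof T' u
      andBuild zero    w le sw _ _ _ _ = ⊥-elim (out-of-fuel sw le)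
      andBuild (suc f) w le sw isOdd tw T' eq with andOne w isOdd sw
      ... | j , sj , _ =
        andProof (trans (↾-root {T} w eq) tw) j
                 (orBuild f (w ∷ʳ j) (fuel-∷ʳ w j f le) sj (trans (even-∷ʳ w j) (cong not isOdd))
                          (proj₂ (andKid-clause j tw sj)) (T' ↓ j) (↾-∷ʳ {T} w eq j))

  success⇒proof : ∀ {T c} → RewLaws T → T [] ≡ just (clauseL c) → IsInductiveSuccessTree T → OrProof T
  success⇒proof {T} laws root (S , subtree , (L , listed) , leaves) =
    orBuild B [] ≤-refl (RewSubtree.hasRoot subtree) refl root T (λ _ → refl)
    where
    B : ℕ
    B = suc (max 0 (map length L))
    shallow : ∀ w → S w → length w < B
    shallow w sw = s≤s (All.lookup (xs≤max 0 _) (∈-map⁺ length (listed w sw)))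
    open FromSubtree laws subtree B shallow leaves

  proof⇔success : ∀ {T c} → RewLaws T → T [] ≡ just (clauseL c) → OrProof T ⇔ IsInductiveSuccessTree T
  proof⇔success laws root = mk⇔ (proof⇒success laws) (success⇒proof laws root)

  -- Tree
  -- nodes are built with the tree's own most general matchers, so an and-node may
  -- carry any instance of a solved atom; (G) lets a derivation follow it there.

  clauseChild : ∀ {T u j c} → RewLaws T → T [] ≡ just (termL u) → (T ↓ j) [] ≡ just (clauseL c) →
                ∃[ D ] ∃[ θ ] (P ‼ j ≡ just D × head D ≺[ θ ] u × c ≡ resolvent θ D)
  clauseChild {T} {u} {j} laws tu tc with P ‼ j | RewLaws.termKids laws [] u tu j
  ... | nothing | tnone              with trans (sym tnone) tc
  ...   | ()
  clauseChild laws tu tc | just D | inj₁ (θ , mgm , tθ) with trans (sym tc) tθ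
  ...   | refl = D , θ , refl , mgm , refl
  clauseChild laws tu tc | just D | inj₂ (_ , _ , tv) with trans (sym tv) tc
  ...   | ()

  matchedChild : ∀ {T u j D} → RewLaws T → T [] ≡ just (termL u) → P ‼ j ≡ just D →
                 ∃[ θ ] (head D ≺[ θ ] u) →
                 ∃[ θ ] (head D ≺[ θ ] u × (T ↓ j) [] ≡ just (clauseL (resolvent θ D)))
  matchedChild {T} {u} {j} laws tu eD matchable with P ‼ j | eD | RewLaws.termKids laws [] u tu j
  ... | just D | refl | inj₁ child           = child
  ... | just D | refl | inj₂ (unmatchable , _) = ⊥-elim (unmatchable matchable)

  mutual
    and⇒solved : ∀ {T u} → RewLaws T → AndProof T u → Solved u
    and⇒solved laws (andProof tu j (orProof c tc κ)) with clauseChild laws tu tc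
    ... | D , θ , eD , mgm , refl =
      resolve j eD θ mgm (subst (All Solved) (map-sub-id _) (kids⇒solved (laws-↓ (laws-↓ laws j)) κ))

    kids⇒solved : ∀ {F bs} → (∀ k → RewLaws (F k)) → KidProofs F bs → All Solved bs
    kids⇒solved laws []      = []
    kids⇒solved laws (α ∷ κ) = and⇒solved (laws 0) α ∷ kids⇒solved (λ k → laws (suc k)) κ

  mutual
    -- a solved atom succeeds at every and-node labelled by one of its instances
    solved⇒and : ∀ {T u u'} → RewLaws T → Solved u → ∀ δ → sub δ u ≡ u' → T [] ≡ just (termL u') →
                 AndProof T u'
    solved⇒and laws (resolve {D = D} j eD σ mgm solvedBody) δ refl tu
      with matchedChild laws tu eD (instance-matchable {head D} {σ} mgm δ)
    ... | θ , mgmθ , tc with mgm-factors {head D} {σ} mgm θ δ (proj₁ mgmθ)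
    ...   | γ , factor =
      andProof tu j (orProof _ tc (instanceKids {σ = σ} (laws-↓ (laws-↓ laws j)) factor solvedBody
                                                (RewLaws.clauseKids (laws-↓ laws j) [] _ tc)))

    -- the body atoms θ(b) of the tree are instances γ(σ(b)) of the solved ones
    instanceKids : ∀ {F σ θ γ bs} → (∀ k → RewLaws (F k)) → (∀ x → sub γ (σ x) ≡ θ x) →
                   All Solved (map (sub σ) bs) →
                   (∀ k → F k [] ≡ Maybe.map termL (map (sub idSubst) (map (sub θ) bs) ‼ k)) →
                   KidProofs F (map (sub idSubst) (map (sub θ) bs))
    instanceKids {bs = []}     laws factor []       labels = []
    instanceKids {bs = b ∷ bs} laws factor (s ∷ ss) labels =
      solved⇒and (laws 0) s _ (sub-factor factor b) (labels 0)
      ∷ instanceKids (λ k → laws (suc k)) factor ss (λ k → labels (suc k))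

  goal⇔proof : ∀ {T} t → RewLaws T → T [] ≡ just (clauseL (subClause idSubst (goal t))) →
               Solved t ⇔ OrProof T
  goal⇔proof {T} t laws root = mk⇔ solved⇒root root⇒solved
    where
    label₀ : (T ↓ 0) [] ≡ just (termL (sub idSubst t))
    label₀ = RewLaws.clauseKids laws [] _ root 0

    solved⇒root : Solved t → OrProof T
    solved⇒root s = orProof _ root (solved⇒and (laws-↓ laws 0) s idSubst refl label₀ ∷ [])

    root⇒solved : OrProof T → Solved t
    root⇒solved (orProof c tc κ) with trans (sym root) tc
    ... | refl with κ
    ...   | α ∷ [] = subst Solved (sub-id t) (and⇒solved (laws-↓ laws 0) α)

proposition3p8 : (Sig : Signature) (P : Program Sig) (t : Term Sig) (T : Tree Sig) →
    IsRewTree P (goal t) idSubst T →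
    ((∃[ n ] StepsAtMost P n (t ∷ []) []) ⇔ IsInductiveSuccessTree T)
-- [t] →* [ ]  ⇔  t is Solved  ⇔  the root of T has a proof  ⇔  T is an inductive success tree
proposition3p8 Sig P t T isRew =
  proof⇔success laws root ⇔-∘ (goal⇔proof t laws root ⇔-∘ solvable⇔solved t)
  where
  open Derivations P
  open Trees P

  root : T [] ≡ just (clauseL (subClause idSubst (goal t)))
  root = IsRewTree.root isRew

  laws : RewLaws T
  laws = rewLaws isRew
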